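{- Let $A$ be a poset with order $\le$, let $(\cdot,\to)$ be an adjunction on $A$, let $1\in A$, and let $\vee$ be a binary operation on $A$. Then the following are equivalent: (a) $A$ is a join-semilattice with join $\vee$ and $(A,\to,1)$ is a wBCK*-algebra; (b) $A$ is a join-semilattice with join $\vee$ and $(A,\cdot,1)$ is a commutative groupoid in which $1$ is a neutral element and the greatest element of $A$; (c) $A$ is a join-semilattice with join $\vee$, $\cdot$ is commutative, $1$ is a neutral element for $\cdot$ and the greatest element of $A$, and $\cdot$ distributes over $\vee$: $(x\vee y)z=xz\vee yz$ and $z(x\vee y)=zx\vee zy$ for all $x,y,z$ (i.e. $(A,\vee,\cdot,1)$ is an integral commutative multiplicative semilattice).
   Context: An adjunction on a poset $A$ is a pair $(\cdot,\to)$ of binary operations on $A$ such that for all $x,y,z$: $x\le y\to z$ iff $x\cdot y\le z$. A wBCK*-algebra is an algebra $(A,\to,1)$ where $A$ is a poset with greatest element $1$, $x\le y$ iff $x\to y=1$, and for all $x,y,z$: if $x\le y\to z$ then $y\le x\to z$. -}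

module Defs where

open import Level using (Level; _⊔_)
open import Data.Product using (_×_)
open import Function.Bundles using (_⇔_)
open import Relation.Binary.Core using (Rel)
open import Relation.Binary.PropositionalEquality using (_≡_)
open import Relation.Binary.Definitions using (Maximum)
open import Relation.Binary.Lattice.Definitions using (Supremum)
open import Algebra.Core using (Op₂)

module _ {a ℓ : Level} {A : Set a} (_≤_ : Rel A ℓ) where

  open import Algebra.Definitions {A = A} _≡_ using (Commutative; Identity; _DistributesOverˡ_; _DistributesOverʳ_)

  IsAdjunction : Op₂ A → Op₂ A → Set (a ⊔ ℓ)
  IsAdjunction _·_ _⇒_ = ∀ x y z → (x ≤ (y ⇒ z)) ⇔ ((x · y) ≤ z)

  IsJoinSemilatticeWith : Op₂ A → Set (a ⊔ ℓ)
  IsJoinSemilatticeWith _∨_ = Supremum _≤_ _∨_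

  IsWBCKStar : Op₂ A → A → Set (a ⊔ ℓ)
  IsWBCKStar _⇒_ 𝟏 =
    Maximum _≤_ 𝟏
    × (∀ x y → (x ≤ y) ⇔ ((x ⇒ y) ≡ 𝟏))
    × (∀ x y z → x ≤ (y ⇒ z) → y ≤ (x ⇒ z))

  IsCommGroupoidNeutralTop : Op₂ A → A → Set (a ⊔ ℓ)
  IsCommGroupoidNeutralTop _·_ 𝟏 =
    Commutative _·_ × Identity 𝟏 _·_ × Maximum _≤_ 𝟏

  -- (A, ∨, ·, 1) is an integral commutative multiplicative semilattice
  -- (given that ∨ is the join): · commutative, 1 neutral and greatest,
  -- · distributes over ∨ on both sides
  IsICMSemilatticeExtra : Op₂ A → Op₂ A → A → Set (a ⊔ ℓ)
  IsICMSemilatticeExtra _∨_ _·_ 𝟏 =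
    Commutative _·_ × Identity 𝟏 _·_ × Maximum _≤_ 𝟏
    × (_·_ DistributesOverʳ _∨_) × (_·_ DistributesOverˡ _∨_)

module Submission where

-- Everything rests on the residuation law  x ≤ y ⇒ z ⟺ x · y ≤ z  and on
-- indirect equality in a poset (p = q once p and q have the same upper, or
-- the same lower, bounds).

open import Defs
open import Level using (Level)
open import Data.Product using (_×_; _,_)
open import Function.Bundles using (_⇔_; mk⇔; Equivalence)
open import Relation.Binary.Core using (Rel)
open import Relation.Binary.PropositionalEquality using (_≡_; sym; subst)
open import Relation.Binary.Structures using (IsPartialOrder)
open import Relation.Binary.Definitions using (Maximum)
open import Relation.Binary.Lattice.Definitions using (Supremum)
open import Algebra.Core using (Op₂)

module IndirectEquality {a ℓ : Level} {A : Set a} {_≤_ : Rel A ℓ}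
                        (po : IsPartialOrder _≡_ _≤_) where

  open IsPartialOrder po using (antisym) renaming (refl to ≤-refl)

  ≡-by-upperBounds : ∀ {p q} → (∀ w → p ≤ w → q ≤ w) → (∀ w → q ≤ w → p ≤ w) → p ≡ q
  ≡-by-upperBounds p≤⇒q≤ q≤⇒p≤ = antisym (q≤⇒p≤ _ ≤-refl) (p≤⇒q≤ _ ≤-refl)

  ≡-by-lowerBounds : ∀ {p q} → (∀ w → w ≤ p → w ≤ q) → (∀ w → w ≤ q → w ≤ p) → p ≡ q
  ≡-by-lowerBounds ≤p⇒≤q ≤q⇒≤p = antisym (≤p⇒≤q _ ≤-refl) (≤q⇒≤p _ ≤-refl)

module Residuation {a ℓ : Level} {A : Set a} {_≤_ : Rel A ℓ}
                   (po : IsPartialOrder _≡_ _≤_)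
                   {_·_ _⇒_ : Op₂ A} (adj : IsAdjunction _≤_ _·_ _⇒_) where

  open IsPartialOrder po using (antisym) renaming (trans to ≤-trans)
  open IndirectEquality po
  open import Algebra.Definitions {A = A} _≡_
    using (Commutative; LeftIdentity; RightIdentity; _DistributesOverʳ_)

  residuate : ∀ {x y z} → x ≤ (y ⇒ z) → (x · y) ≤ z
  residuate {x} {y} {z} = Equivalence.to (adj x y z)

  unresiduate : ∀ {x y z} → (x · y) ≤ z → x ≤ (y ⇒ z)
  unresiduate {x} {y} {z} = Equivalence.from (adj x y z)

  Exchange : Set _
  Exchange = ∀ x y z → x ≤ (y ⇒ z) → y ≤ (x ⇒ z)

  -- Under residuation the exchange law says that x · y and y · x have the
  -- same upper bounds.
  exchange⇒comm : Exchange → Commutative _·_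
  exchange⇒comm exchange x y = ≡-by-upperBounds swap swap
    where
    swap : ∀ {u v} w → (u · v) ≤ w → (v · u) ≤ w
    swap w uv≤w = residuate (exchange _ _ _ (unresiduate uv≤w))

  comm⇒exchange : Commutative _·_ → Exchange
  comm⇒exchange comm x y z x≤y⇒z =
    unresiduate (subst (_≤ z) (comm x y) (residuate x≤y⇒z))

  -- If 𝟏 ⇒ _ is the identity map then x · 𝟏 and x have the same upper bounds.
  ⇒-identityˡ⇒·-identityʳ : ∀ {𝟏} → (∀ z → (𝟏 ⇒ z) ≡ z) → RightIdentity 𝟏 _·_
  ⇒-identityˡ⇒·-identityʳ 𝟏⇒z≡z x = ≡-by-upperBounds
    (λ w x𝟏≤w → subst (x ≤_) (𝟏⇒z≡z w) (unresiduate x𝟏≤w))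
    (λ w x≤w → residuate (subst (x ≤_) (sym (𝟏⇒z≡z w)) x≤w))

  -- In a wBCK*-algebra, 𝟏 ⇒ z = z: w ≤ 𝟏 ⇒ z  iff  𝟏 ≤ w ⇒ z (exchange and
  -- maximality of 𝟏)  iff  w ⇒ z = 𝟏  iff  w ≤ z.
  wBCK*⇒⇒-identityˡ : ∀ {𝟏} → IsWBCKStar _≤_ _⇒_ 𝟏 → ∀ z → (𝟏 ⇒ z) ≡ z
  wBCK*⇒⇒-identityˡ {𝟏} (top , order , exchange) z = ≡-by-lowerBounds
    (λ w w≤𝟏⇒z → Equivalence.from (order w z) (antisym (top _) (exchange _ _ _ w≤𝟏⇒z)))
    (λ w w≤z → exchange _ _ _ (subst (𝟏 ≤_) (sym (Equivalence.to (order w z) w≤z)) (top 𝟏)))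

  -- If 𝟏 is a greatest left identity of ·, then x ≤ y  iff  𝟏 · x ≤ y
  -- iff  𝟏 ≤ x ⇒ y  iff  x ⇒ y = 𝟏.
  identityˡ∧top⇒order : ∀ {𝟏} → LeftIdentity 𝟏 _·_ → Maximum _≤_ 𝟏
                      → ∀ x y → (x ≤ y) ⇔ ((x ⇒ y) ≡ 𝟏)
  identityˡ∧top⇒order {𝟏} identityˡ top x y = mk⇔
    (λ x≤y → antisym (top _) (unresiduate (subst (_≤ y) (sym (identityˡ x)) x≤y)))
    (λ x⇒y≡𝟏 → subst (_≤ y) (identityˡ x) (residuate (subst (𝟏 ≤_) (sym x⇒y≡𝟏) (top 𝟏))))

  -- _· z is a left adjoint, so it preserves every existing binary join.
  ·-distribʳ-join : ∀ {_∨_} → Supremum _≤_ _∨_ → _·_ DistributesOverʳ _∨_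
  ·-distribʳ-join {_∨_} sup z x y = ≡-by-upperBounds join·≤⇒·join≤ ·join≤⇒join·≤
    where
    join·≤⇒·join≤ : ∀ w → ((x ∨ y) · z) ≤ w → ((x · z) ∨ (y · z)) ≤ w
    join·≤⇒·join≤ w x∨y·z≤w =
      let (x≤x∨y , y≤x∨y , _) = sup x y
          (_ , _ , least) = sup (x · z) (y · z)
          x∨y≤z⇒w = unresiduate x∨y·z≤w
      in least w (residuate (≤-trans x≤x∨y x∨y≤z⇒w)) (residuate (≤-trans y≤x∨y x∨y≤z⇒w))

    ·join≤⇒join·≤ : ∀ w → ((x · z) ∨ (y · z)) ≤ w → ((x ∨ y) · z) ≤ w
    ·join≤⇒join·≤ w join≤w =
      let (xz≤join , yz≤join , _) = sup (x · z) (y · z)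
          (_ , _ , least) = sup x y
      in residuate (least _ (unresiduate (≤-trans xz≤join join≤w))
                            (unresiduate (≤-trans yz≤join join≤w)))

theorem4p8 : {a ℓ : Level} {A : Set a} (_≤_ : Rel A ℓ) → IsPartialOrder _≡_ _≤_
    → (_·_ _⇒_ : Op₂ A) → IsAdjunction _≤_ _·_ _⇒_ → (𝟏 : A) → (_∨_ : Op₂ A)
    → ((IsJoinSemilatticeWith _≤_ _∨_ × IsWBCKStar _≤_ _⇒_ 𝟏)
    ⇔ (IsJoinSemilatticeWith _≤_ _∨_ × IsCommGroupoidNeutralTop _≤_ _·_ 𝟏))
    × ((IsJoinSemilatticeWith _≤_ _∨_ × IsCommGroupoidNeutralTop _≤_ _·_ 𝟏)
    ⇔ (IsJoinSemilatticeWith _≤_ _∨_ × IsICMSemilatticeExtra _≤_ _∨_ _·_ 𝟏))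
theorem4p8 {A = A} _≤_ po _·_ _⇒_ adj 𝟏 _∨_ = mk⇔ a⇒b b⇒a , mk⇔ b⇒c c⇒b
  where
  open Residuation po adj
  open import Algebra.Definitions {A = A} _≡_
    using (Commutative; Identity; _DistributesOverʳ_)
  open import Algebra.Consequences.Propositional {A = A}
    using (comm∧idʳ⇒id; comm∧distrʳ⇒distrˡ)

  a⇒b : IsJoinSemilatticeWith _≤_ _∨_ × IsWBCKStar _≤_ _⇒_ 𝟏
      → IsJoinSemilatticeWith _≤_ _∨_ × IsCommGroupoidNeutralTop _≤_ _·_ 𝟏
  a⇒b (sup , wBCK*@(top , _ , exchange)) = sup , comm , identity , top
    where
    comm : Commutative _·_
    comm = exchange⇒comm exchange

    identity : Identity 𝟏 _·_
    identity = comm∧idʳ⇒id comm (⇒-identityˡ⇒·-identityʳ (wBCK*⇒⇒-identityˡ wBCK*))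

  b⇒a : IsJoinSemilatticeWith _≤_ _∨_ × IsCommGroupoidNeutralTop _≤_ _·_ 𝟏
      → IsJoinSemilatticeWith _≤_ _∨_ × IsWBCKStar _≤_ _⇒_ 𝟏
  b⇒a (sup , comm , (identityˡ , _) , top) =
    sup , top , identityˡ∧top⇒order identityˡ top , comm⇒exchange comm

  b⇒c : IsJoinSemilatticeWith _≤_ _∨_ × IsCommGroupoidNeutralTop _≤_ _·_ 𝟏
      → IsJoinSemilatticeWith _≤_ _∨_ × IsICMSemilatticeExtra _≤_ _∨_ _·_ 𝟏
  b⇒c (sup , comm , identity , top) =
    sup , comm , identity , top , distribʳ , comm∧distrʳ⇒distrˡ comm distribʳ
    where
    distribʳ : _·_ DistributesOverʳ _∨_
    distribʳ = ·-distribʳ-join sup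

  c⇒b : IsJoinSemilatticeWith _≤_ _∨_ × IsICMSemilatticeExtra _≤_ _∨_ _·_ 𝟏
      → IsJoinSemilatticeWith _≤_ _∨_ × IsCommGroupoidNeutralTop _≤_ _·_ 𝟏
  c⇒b (sup , comm , identity , top , _ , _) = sup , comm , identity , top
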